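{- Let $p$ be a prime, let $\alpha_{ -1},\alpha_0,\alpha_1\in\mathbb{Z}$, $P(x)=\alpha_{ -1}x^{ -1}+\alpha_0+\alpha_1x$, and $a_n=ct\left[P(x)^n\right]$. Suppose $p\nmid a_n$ for all $n\ge 0$. Then for every $n\in\mathbb{Z}_{\ge 0}$ there exists $n'\in\mathbb{Z}_{\ge 0}$ with $n'>n$, $n'-n<p^{p^{(p-1)}+p+1}$, and $a_n\equiv a_{n'}\pmod p$.
   Context: $ct[R(x)]$ denotes the constant term of a Laurent polynomial $R(x)$ with integer coefficients. -}

module Defs where

open import Data.Nat using (ℕ; zero; suc)
open import Data.Integer using (ℤ; +_; -[1+_]; 0ℤ; 1ℤ) renaming (_+_ to _+ℤ_; _*_ to _*ℤ_; -_ to -ℤ_; _-_ to _-ℤ_)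
open import Data.List using (List; []; _∷_)

-- A Laurent polynomial with integer coefficients, represented as
--   Σ_i coeffs[i] · x^(low + i).
record Laurent : Set where
  constructor laurent
  field
    low    : ℤ
    coeffs : List ℤ
open Laurent public

-- coefficient list addition (aligned at the same lowest exponent)
addL : List ℤ → List ℤ → List ℤ
addL [] ys = ys
addL xs [] = xs
addL (x ∷ xs) (y ∷ ys) = (x +ℤ y) ∷ addL xs ys

scaleL : ℤ → List ℤ → List ℤ
scaleL c [] = []
scaleL c (x ∷ xs) = (c *ℤ x) ∷ scaleL c xs

mulL : List ℤ → List ℤ → List ℤ
mulL [] ys = []
mulL (x ∷ xs) ys = addL (scaleL x ys) (0ℤ ∷ mulL xs ys)

_*L_ : Laurent → Laurent → Laurent
laurent l₁ c₁ *L laurent l₂ c₂ = laurent (l₁ +ℤ l₂) (mulL c₁ c₂)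

oneL : Laurent
oneL = laurent 0ℤ (1ℤ ∷ [])

_^L_ : Laurent → ℕ → Laurent
P ^L zero = oneL
P ^L suc n = P *L (P ^L n)

nthL : List ℤ → ℕ → ℤ
nthL [] _ = 0ℤ
nthL (x ∷ xs) zero = x
nthL (x ∷ xs) (suc k) = nthL xs k

coeffAt : Laurent → ℤ → ℤ
coeffAt (laurent l c) k with k -ℤ l
... | + i = nthL c i
... | -[1+ _ ] = 0ℤ

ct : Laurent → ℤ
ct R = coeffAt R 0ℤ

P₃ : ℤ → ℤ → ℤ → Laurent
P₃ αm α0 α1 = laurent (-ℤ 1ℤ) (αm ∷ α0 ∷ α1 ∷ [])

seqA : ℤ → ℤ → ℤ → ℕ → ℤ
seqA αm α0 α1 n = ct (P₃ αm α0 α1 ^L n)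

-- Modulo p, multiplication by P(x) acts on coefficient sequences ℤ → ℤ as a sum of three
-- commuting scaled shift operators, so Frobenius in characteristic p and Fermat's little
-- theorem give P(x)^p ≡ P(x^p). Comparing coefficients yields the Lucas property
-- a(pm + r) ≡ a(r)·a(m) for r < p, hence a(p^K·q + r) ≡ a(r)·a(q) for r < p^K: concatenating
-- base-p digits multiplies the values of a. So products of values of a are again values, and by
-- pigeonhole on the residues of a(x mod p^i), 0 ≤ i ≤ p, every value is taken at an index below
-- p^p. Write n = p^p·Q + R and choose y < p^p with a(y) ≡ a(n)·a(Q+1)^(p-2); then
-- n′ = p^p·(Q+1) + y has a(n′) ≡ a(n)·a(Q+1)^(p-1) ≡ a(n), since p ∤ a(Q+1), and
-- n < n′ < n + 2·p^p, far inside the required bound.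

module Submission where

open import Algebra.Bundles using (Semiring)
open import Data.Integer using (ℤ)
open import Data.Nat using (ℕ)
open import Data.Nat.Primality using (Prime)

module BinomialCoefficients where
  open import Data.Nat using (zero; suc; _*_; _∸_; _≤_; _<_; _!)
  open import Data.Nat.Properties using (<⇒≤; <⇒≱; n<1+n; <-trans; ∸-monoʳ-<; _!*_!≢0)
  open import Data.Nat.Combinatorics using (_C_; k![n∸k]!∣n!)
  open import Data.Nat.Combinatorics.Specification using (nCk≡n!/k![n-k]!)
  open import Data.Nat.DivMod using (m/n*n≡m)
  open import Data.Nat.Divisibility using (_∣_; ∣⇒≤; ∣1⇒≡1; m∣m*n)
  open import Data.Nat.Primality using (euclidsLemma; ¬prime[1])
  open import Data.Sum using (inj₁; inj₂)
  open import Relation.Nullary using (¬_; contradiction)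
  open import Relation.Binary.PropositionalEquality using (_≡_; sym; trans; cong; subst)

  prime∤! : ∀ {p m} → Prime p → m < p → ¬ p ∣ m !
  prime∤! {m = zero} p-prime _ p∣1 = ¬prime[1] (subst Prime (∣1⇒≡1 p∣1) p-prime)
  prime∤! {m = suc m} p-prime m<p p∣m! with euclidsLemma (suc m) (m !) p-prime p∣m!
  ... | inj₁ p∣1+m = <⇒≱ m<p (∣⇒≤ p∣1+m)
  ... | inj₂ p∣m! = prime∤! p-prime (<-trans (n<1+n m) m<p) p∣m!

  choose*factorials≡! : ∀ {n k} → k ≤ n → (n C k) * (k ! * (n ∸ k) !) ≡ n !
  choose*factorials≡! {n} {k} k≤n = trans (cong (_* (k ! * (n ∸ k) !)) (nCk≡n!/k![n-k]! k≤n))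
                                          (m/n*n≡m {{k !* (n ∸ k) !≢0}} (k![n∸k]!∣n! k≤n))

  prime∣choose : ∀ {p k} → Prime p → 0 < k → k < p → p ∣ p C k
  prime∣choose {suc q} {k} p-prime 0<k k<p
    with euclidsLemma (suc q C k) _ p-prime
           (subst (suc q ∣_) (sym (choose*factorials≡! (<⇒≤ k<p))) (m∣m*n (q !)))
  ... | inj₁ p∣pCk = p∣pCk
  ... | inj₂ p∣k!*[p-k]! with euclidsLemma (k !) ((suc q ∸ k) !) p-prime p∣k!*[p-k]!
  ...   | inj₁ p∣k! = contradiction p∣k! (prime∤! p-prime k<p)
  ...   | inj₂ p∣[p-k]! = contradiction p∣[p-k]! (prime∤! p-prime (∸-monoʳ-< {suc q} {k} {0} 0<k (<⇒≤ k<p)))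

module Frobenius {c ℓ} (R : Semiring c ℓ) where
  open import Data.Nat as ℕ using (zero; suc; _<_; z<s; s<s)
  open import Data.Nat.Properties using (n∸n≡0; *-comm)
  open import Data.Nat.Combinatorics using (_C_; nCn≡1)
  open import Data.Nat.Divisibility using (divides)
  open import Data.Fin using (Fin; zero; suc; toℕ; inject₁; fromℕ)
  open import Data.Fin.Properties using (toℕ<n; toℕ-inject₁; toℕ-fromℕ)
  import Relation.Binary.PropositionalEquality as ≡
  open BinomialCoefficients using (prime∣choose)
  open Semiring R hiding (zero)
  open import Algebra.Properties.Semiring.Exp R using (_^_)
  open import Algebra.Properties.Semiring.Mult R using (_×_; ×-assocˡ)
  open import Algebra.Properties.Monoid.Sum +-monoid using (sum; sum-cong-≋; sum-replicate-zero; sum-init-last)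
  open import Relation.Binary.Reasoning.Setoid setoid

  *-comm-+ : ∀ {x y z} → x * y ≈ y * x → x * z ≈ z * x → x * (y + z) ≈ (y + z) * x
  *-comm-+ {x} {y} {z} xy≈yx xz≈zx = begin
    x * (y + z)     ≈⟨ distribˡ x y z ⟩
    x * y + x * z   ≈⟨ +-cong xy≈yx xz≈zx ⟩
    y * x + z * x   ≈⟨ distribʳ x y z ⟨
    (y + z) * x     ∎

  frobenius : ∀ {p} → Prime p → (∀ x → p × x ≈ 0#) →
              ∀ {x y} → x * y ≈ y * x → (x + y) ^ p ≈ x ^ p + y ^ p
  frobenius {suc q} p-prime p×≈0 {x} {y} xy≈yx = begin
    (x + y) ^ p
      ≈⟨ theorem xy≈yx p ⟩
    binomialTerm p zero + sum (λ i → binomialTerm p (suc i))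
      ≈⟨ +-cong lowest (sum-init-last (λ i → binomialTerm p (suc i))) ⟩
    y ^ p + (sum middleTerm + binomialTerm p (suc (fromℕ q)))
      ≈⟨ +-congˡ (+-cong middle≈0 highest) ⟩
    y ^ p + (0# + x ^ p)
      ≈⟨ +-congˡ (+-identityˡ (x ^ p)) ⟩
    y ^ p + x ^ p
      ≈⟨ +-comm (y ^ p) (x ^ p) ⟩
    x ^ p + y ^ p
      ∎
    where
    open import Algebra.Properties.Semiring.Binomial R x y using (theorem; binomial; binomialTerm)
    p = suc q

    lowest : binomialTerm p zero ≈ y ^ p
    lowest = trans (+-identityʳ _) (*-identityˡ (y ^ p))

    highest : binomialTerm p (suc (fromℕ q)) ≈ x ^ p
    highest rewrite toℕ-fromℕ q | nCn≡1 p | n∸n≡0 p = trans (+-identityʳ _) (*-identityʳ (x ^ p))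

    vanishing : ∀ i → 0 < toℕ i → toℕ i < p → binomialTerm p i ≈ 0#
    vanishing i 0<i i<p with prime∣choose p-prime 0<i i<p
    ... | divides m pCi≡m*p = begin
        (p C toℕ i) × binomial p i   ≡⟨ ≡.cong (_× binomial p i) (≡.trans pCi≡m*p (*-comm m p)) ⟩
        (p ℕ.* m) × binomial p i     ≈⟨ ×-assocˡ (binomial p i) p m ⟨
        p × (m × binomial p i)       ≈⟨ p×≈0 (m × binomial p i) ⟩
        0#                           ∎

    middleTerm : Fin q → Carrier
    middleTerm i = binomialTerm p (suc (inject₁ i))

    middle≈0 : sum middleTerm ≈ 0#
    middle≈0 = trans (sum-cong-≋ (λ i → vanishing _ z<s (s<s (≡.subst (_< q) (≡.sym (toℕ-inject₁ i)) (toℕ<n i)))))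
                     (sum-replicate-zero q)

module Congruence (m : ℤ) where
  open import Level using (0ℓ)
  open import Data.Integer using (+_; 0ℤ; 1ℤ; _+_; _*_; -_; _-_)
  import Data.Integer.Properties as ℤ
  open import Data.Integer.Divisibility using (_∣_)
  import Data.Integer.Divisibility.Signed as Signed
  open import Data.Integer.Tactic.RingSolver using (solve)
  open import Data.List using (_∷_; [])
  open import Relation.Binary.Structures using (IsEquivalence)
  open import Data.Product using (_,_)
  open import Relation.Binary.PropositionalEquality using (_≡_; refl; sym; trans; cong)

  infix 4 _≈_
  record _≈_ (x y : ℤ) : Set where
    constructor mk≈
    field
      quotient : ℤ
      equation : x ≡ y + quotient * m

  ≈-reflexive : ∀ {x y} → x ≡ y → x ≈ y
  ≈-reflexive {x} refl = mk≈ 0ℤ (solve (x ∷ m ∷ []))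

  ≈-refl : ∀ {x} → x ≈ x
  ≈-refl = ≈-reflexive refl

  ≈-sym : ∀ {x y} → x ≈ y → y ≈ x
  ≈-sym {y = y} (mk≈ q refl) = mk≈ (- q) (solve (y ∷ q ∷ m ∷ []))

  ≈-trans : ∀ {x y z} → x ≈ y → y ≈ z → x ≈ z
  ≈-trans {z = z} (mk≈ q refl) (mk≈ r refl) = mk≈ (q + r) (solve (z ∷ q ∷ r ∷ m ∷ []))

  +-cong : ∀ {x x′ y y′} → x ≈ x′ → y ≈ y′ → x + y ≈ x′ + y′
  +-cong {x′ = x′} {y′ = y′} (mk≈ q refl) (mk≈ r refl) = mk≈ (q + r) (solve (x′ ∷ y′ ∷ q ∷ r ∷ m ∷ []))

  *-cong : ∀ {x x′ y y′} → x ≈ x′ → y ≈ y′ → x * y ≈ x′ * y′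
  *-cong {x′ = x′} {y′ = y′} (mk≈ q refl) (mk≈ r refl) =
    mk≈ (q * y′ + x′ * r + q * r * m) (solve (x′ ∷ y′ ∷ q ∷ r ∷ m ∷ []))

  multiple≈0 : ∀ q → q * m ≈ 0ℤ
  multiple≈0 q = mk≈ q (sym (ℤ.+-identityˡ (q * m)))

  ≈-isEquivalence : IsEquivalence _≈_
  ≈-isEquivalence = record { refl = ≈-refl ; sym = ≈-sym ; trans = ≈-trans }

  semiring : Semiring 0ℓ 0ℓ
  semiring = record
    { Carrier = ℤ ; _≈_ = _≈_ ; _+_ = _+_ ; _*_ = _*_ ; 0# = 0ℤ ; 1# = 1ℤ
    ; isSemiring = record
      { isSemiringWithoutAnnihilatingZero = record
        { +-isCommutativeMonoid = record
          { isMonoid = record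
            { isSemigroup = record
              { isMagma = record { isEquivalence = ≈-isEquivalence ; ∙-cong = +-cong }
              ; assoc = λ x y z → ≈-reflexive (ℤ.+-assoc x y z) }
            ; identity = (λ x → ≈-reflexive (ℤ.+-identityˡ x)) , (λ x → ≈-reflexive (ℤ.+-identityʳ x)) }
          ; comm = λ x y → ≈-reflexive (ℤ.+-comm x y) }
        ; *-cong = *-cong
        ; *-assoc = λ x y z → ≈-reflexive (ℤ.*-assoc x y z)
        ; *-identity = (λ x → ≈-reflexive (ℤ.*-identityˡ x)) , (λ x → ≈-reflexive (ℤ.*-identityʳ x))
        ; distrib = (λ x y z → ≈-reflexive (ℤ.*-distribˡ-+ x y z)) , (λ x y z → ≈-reflexive (ℤ.*-distribʳ-+ x y z)) }
      ; zero = (λ x → ≈-reflexive (ℤ.*-zeroˡ x)) , (λ x → ≈-reflexive (ℤ.*-zeroʳ x)) } }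

  ≈⇒∣- : ∀ {x y} → x ≈ y → m ∣ x - y
  ≈⇒∣- {y = y} (mk≈ q refl) = Signed.∣⇒∣ᵤ (Signed.divides q x-y≡q*m)
    where
    x-y≡q*m : y + q * m - y ≡ q * m
    x-y≡q*m = solve (y ∷ q ∷ m ∷ [])

  ∣-⇒≈ : ∀ {x y} → m ∣ x - y → x ≈ y
  ∣-⇒≈ {x} {y} m∣x-y with Signed.∣ᵤ⇒∣ m∣x-y
  ... | Signed.divides q x-y≡q*m = mk≈ q (trans x≡y+[x-y] (cong (_+_ y) x-y≡q*m))
    where
    x≡y+[x-y] : x ≡ y + (x - y)
    x≡y+[x-y] = solve (x ∷ y ∷ [])

module PrimeModulus (p : ℕ) (p-prime : Prime p) where
  open import Data.Nat as ℕ using (zero; suc; _∸_; NonZero)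
  import Data.Nat.Properties as ℕ
  open import Data.Nat.Primality using (prime⇒nonZero; prime⇒nonTrivial; euclidsLemma)
  open import Data.Integer using (+_; 0ℤ; 1ℤ; _+_; _*_; -_; _-_; ∣_∣)
  import Data.Integer.Properties as ℤ
  open import Data.Integer.DivMod using (_%ℕ_; _/ℕ_; n%ℕd<d; a≡a%ℕn+[a/ℕn]*n)
  open import Data.Integer.Divisibility using (_∣_)
  open import Data.Nat.Divisibility using () renaming (_∣_ to _∣ℕ_)
  open import Data.Integer.Tactic.RingSolver using (solve)
  open import Data.Fin using (Fin; toℕ; fromℕ<)
  open import Data.Fin.Properties using (toℕ-fromℕ<)
  open import Data.List using (_∷_; [])
  open import Data.Sum using (inj₁; inj₂)
  open import Relation.Nullary using (¬_; contradiction)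
  open import Relation.Binary.PropositionalEquality using (_≡_; refl; sym; trans; cong; subst)

  open Congruence (+ p) public
  open import Algebra.Properties.Semiring.Exp semiring public using (_^_; ^-congˡ)
  open import Algebra.Properties.Semiring.Mult semiring using (_×_)
  open Frobenius semiring using (frobenius)
  open import Relation.Binary.Reasoning.Setoid (Semiring.setoid semiring)

  instance
    p≢0 : NonZero p
    p≢0 = prime⇒nonZero p-prime

  p>1 : p ℕ.> 1
  p>1 = ℕ.nonTrivial⇒n>1 p {{prime⇒nonTrivial p-prime}}

  ×≡* : ∀ n x → n × x ≡ + n * x
  ×≡* zero x = refl
  ×≡* (suc n) x = trans (cong (_+_ x) (×≡* n x)) (sym (ℤ.suc-* (+ n) x))

  p×≈0 : ∀ x → p × x ≈ 0ℤ
  p×≈0 x = ≈-trans (≈-reflexive (trans (×≡* p x) (ℤ.*-comm (+ p) x))) (multiple≈0 x)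

  ≈-%ℕ : ∀ x → x ≈ + (x %ℕ p)
  ≈-%ℕ x = mk≈ (x /ℕ p) (a≡a%ℕn+[a/ℕn]*n x p)

  residue : ℤ → Fin p
  residue x = fromℕ< (n%ℕd<d x p)

  residue-≡⇒≈ : ∀ {x y} → residue x ≡ residue y → x ≈ y
  residue-≡⇒≈ {x} {y} eq = begin
    x                      ≈⟨ ≈-%ℕ x ⟩
    + (x %ℕ p)             ≡⟨ cong +_ (sym (toℕ-fromℕ< (n%ℕd<d x p))) ⟩
    + toℕ (residue x)      ≡⟨ cong (λ r → + toℕ r) eq ⟩
    + toℕ (residue y)      ≡⟨ cong +_ (toℕ-fromℕ< (n%ℕd<d y p)) ⟩
    + (y %ℕ p)             ≈⟨ ≈-%ℕ y ⟨
    y                      ∎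

  1^n≡1 : ∀ n → 1ℤ ^ n ≡ 1ℤ
  1^n≡1 zero = refl
  1^n≡1 (suc n) = cong (1ℤ *_) (1^n≡1 n)

  0^n≡0 : ∀ n → .{{NonZero n}} → 0ℤ ^ n ≡ 0ℤ
  0^n≡0 (suc n) = refl

  fermat-ℕ : ∀ n → (+ n) ^ p ≈ + n
  fermat-ℕ zero = ≈-reflexive (0^n≡0 p)
  fermat-ℕ (suc n) = begin
    (1ℤ + + n) ^ p       ≈⟨ frobenius p-prime p×≈0 (≈-reflexive (ℤ.*-comm 1ℤ (+ n))) ⟩
    1ℤ ^ p + (+ n) ^ p   ≈⟨ +-cong (≈-reflexive (1^n≡1 p)) (fermat-ℕ n) ⟩
    1ℤ + + n             ∎

  fermat : ∀ x → x ^ p ≈ x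
  fermat x = begin
    x ^ p             ≈⟨ ^-congˡ p (≈-%ℕ x) ⟩
    (+ (x %ℕ p)) ^ p  ≈⟨ fermat-ℕ (x %ℕ p) ⟩
    + (x %ℕ p)        ≈⟨ ≈-%ℕ x ⟨
    x                 ∎

  *-cancelˡ-≈ : ∀ {x y z} → ¬ + p ∣ x → x * y ≈ x * z → y ≈ z
  *-cancelˡ-≈ {x} {y} {z} p∤x xy≈xz
    with euclidsLemma ∣ x ∣ ∣ y - z ∣ p-prime (subst (p ∣ℕ_) (ℤ.abs-* x (y - z)) p∣x[y-z])
    where
    factor : x * y - x * z ≡ x * (y - z)
    factor = solve (x ∷ y ∷ z ∷ [])
    p∣x[y-z] : + p ∣ x * (y - z)
    p∣x[y-z] = subst (+ p ∣_) factor (≈⇒∣- xy≈xz)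
  ... | inj₁ p∣x = contradiction p∣x p∤x
  ... | inj₂ p∣y-z = ∣-⇒≈ p∣y-z

  fermat-inverse : ∀ {x} → ¬ + p ∣ x → x * x ^ (p ∸ 2) ≈ 1ℤ
  fermat-inverse {x} p∤x = *-cancelˡ-≈ {x} p∤x (begin
    x * (x * x ^ (p ∸ 2))   ≡⟨ cong (x ^_) 2+[p∸2]≡p ⟩
    x ^ p                   ≈⟨ fermat x ⟩
    x                       ≡⟨ ℤ.*-identityʳ x ⟨
    x * 1ℤ                  ∎)
    where
    2+[p∸2]≡p : 2 ℕ.+ (p ∸ 2) ≡ p
    2+[p∸2]≡p = ℕ.m+[n∸m]≡n p>1

module Operators (p : ℕ) where
  open import Level using (0ℓ)
  open import Data.Nat using (zero; suc)
  open import Data.Integer using (+_; 0ℤ; 1ℤ; _+_; _*_)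
  import Data.Integer.Properties as ℤ
  open import Data.Integer.Tactic.RingSolver using (solve; solve-∀)
  open import Data.List using (_∷_; [])
  open import Data.Product using (_,_)
  open import Relation.Binary.PropositionalEquality using (_≡_; refl; sym; trans; cong; module ≡-Reasoning)
  open Congruence (+ p)
  open import Algebra.Properties.Semiring.Exp semiring using (_^_)
  open import Algebra.Properties.CommutativeSemigroup ℤ.+-commutativeSemigroup using (interchange)
  open import Algebra.Properties.CommutativeSemigroup ℤ.*-commutativeSemigroup using (x∙yz≈y∙xz)

  record Operator : Set where
    field
      apply      : (ℤ → ℤ) → ℤ → ℤ
      apply-cong : ∀ {f g} → (∀ k → f k ≈ g k) → ∀ k → apply f k ≈ apply g k
      apply-+    : ∀ f g k → apply (λ j → f j + g j) k ≈ apply f k + apply g k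
      apply-0    : ∀ k → apply (λ _ → 0ℤ) k ≈ 0ℤ
  open Operator public

  infix 4 _≋_
  _≋_ : Operator → Operator → Set
  F ≋ G = ∀ f k → apply F f k ≈ apply G f k

  infixl 6 _⊕_
  _⊕_ : Operator → Operator → Operator
  F ⊕ G = record
    { apply      = λ f k → apply F f k + apply G f k
    ; apply-cong = λ f≈g k → +-cong (apply-cong F f≈g k) (apply-cong G f≈g k)
    ; apply-+    = λ f g k → ≈-trans (+-cong (apply-+ F f g k) (apply-+ G f g k))
                                     (≈-reflexive (interchange (apply F f k) (apply F g k) (apply G f k) (apply G g k)))
    ; apply-0    = λ k → +-cong (apply-0 F k) (apply-0 G k)
    }

  infixl 7 _⊙_
  _⊙_ : Operator → Operator → Operator
  F ⊙ G = record
    { apply      = λ f → apply F (apply G f)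
    ; apply-cong = λ f≈g → apply-cong F (apply-cong G f≈g)
    ; apply-+    = λ f g k → ≈-trans (apply-cong F (apply-+ G f g) k) (apply-+ F (apply G f) (apply G g) k)
    ; apply-0    = λ k → ≈-trans (apply-cong F (apply-0 G) k) (apply-0 F k)
    }

  𝟎 : Operator
  𝟎 = record { apply = λ _ _ → 0ℤ ; apply-cong = λ _ _ → ≈-refl ; apply-+ = λ _ _ _ → ≈-refl ; apply-0 = λ _ → ≈-refl }

  𝟏 : Operator
  𝟏 = record { apply = λ f → f ; apply-cong = λ f≈g → f≈g ; apply-+ = λ _ _ _ → ≈-refl ; apply-0 = λ _ → ≈-refl }

  operator-semiring : Semiring 0ℓ 0ℓ
  operator-semiring = record
    { Carrier = Operator ; _≈_ = _≋_ ; _+_ = _⊕_ ; _*_ = _⊙_ ; 0# = 𝟎 ; 1# = 𝟏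
    ; isSemiring = record
      { isSemiringWithoutAnnihilatingZero = record
        { +-isCommutativeMonoid = record
          { isMonoid = record
            { isSemigroup = record
              { isMagma = record
                { isEquivalence = record
                  { refl  = λ _ _ → ≈-refl
                  ; sym   = λ F≋G f k → ≈-sym (F≋G f k)
                  ; trans = λ F≋G G≋H f k → ≈-trans (F≋G f k) (G≋H f k) }
                ; ∙-cong = λ F≋F′ G≋G′ f k → +-cong (F≋F′ f k) (G≋G′ f k) }
              ; assoc = λ F G H f k → ≈-reflexive (ℤ.+-assoc (apply F f k) (apply G f k) (apply H f k)) }
            ; identity = (λ F f k → ≈-reflexive (ℤ.+-identityˡ (apply F f k)))
                       , (λ F f k → ≈-reflexive (ℤ.+-identityʳ (apply F f k))) }
          ; comm = λ F G f k → ≈-reflexive (ℤ.+-comm (apply F f k) (apply G f k)) }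
        ; *-cong = λ {F} {F′} {G} {G′} F≋F′ G≋G′ f k → ≈-trans (apply-cong F (G≋G′ f) k) (F≋F′ (apply G′ f) k)
        ; *-assoc = λ _ _ _ _ _ → ≈-refl
        ; *-identity = (λ _ _ _ → ≈-refl) , (λ _ _ _ → ≈-refl)
        ; distrib = (λ F G H f k → apply-+ F (apply G f) (apply H f) k) , (λ _ _ _ _ _ → ≈-refl) }
      ; zero = (λ _ _ _ → ≈-refl) , (λ F _ k → apply-0 F k) } }

  open import Algebra.Properties.Semiring.Exp operator-semiring using () renaming (_^_ to _^ᵒ_)
  open import Algebra.Properties.Semiring.Mult operator-semiring using (_×_)

  apply-× : ∀ n F f k → apply (n × F) f k ≡ + n * apply F f k
  apply-× zero F f k = refl
  apply-× (suc n) F f k = trans (cong (_+_ (apply F f k)) (apply-× n F f k)) (sym (ℤ.suc-* (+ n) (apply F f k)))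

  p×≋𝟎 : ∀ F → p × F ≋ 𝟎
  p×≋𝟎 F f k = ≈-trans (≈-reflexive (trans (apply-× p F f k) (ℤ.*-comm (+ p) _))) (multiple≈0 (apply F f k))

  -- Multiplication of a coefficient sequence by a·x⁻ᵈ.
  shift : ℤ → ℤ → Operator
  shift a d = record
    { apply      = λ f k → a * f (k + d)
    ; apply-cong = λ f≈g k → *-cong (≈-refl {a}) (f≈g (k + d))
    ; apply-+    = λ f g k → ≈-reflexive (ℤ.*-distribˡ-+ a (f (k + d)) (g (k + d)))
    ; apply-0    = λ _ → ≈-reflexive (ℤ.*-zeroʳ a)
    }

  apply-shift-^ : ∀ a d n f k → apply (shift a d ^ᵒ n) f k ≡ a ^ n * f (k + + n * d)
  apply-shift-^ a d zero f k = trans (cong f (sym (ℤ.+-identityʳ k))) (sym (ℤ.*-identityˡ _))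
  apply-shift-^ a d (suc n) f k = begin
    a * apply (shift a d ^ᵒ n) f (k + d) ≡⟨ cong (a *_) (apply-shift-^ a d n f (k + d)) ⟩
    a * (a ^ n * f (k + d + + n * d))   ≡⟨ ℤ.*-assoc a (a ^ n) _ ⟨
    a * a ^ n * f (k + d + + n * d)     ≡⟨ cong (λ j → a * a ^ n * f j) (index k d (+ n)) ⟩
    a * a ^ n * f (k + + suc n * d)     ∎
    where
    open ≡-Reasoning
    index : ∀ k d n → k + d + n * d ≡ k + (1ℤ + n) * d
    index = solve-∀

  shift-comm : ∀ a d b e → shift a d ⊙ shift b e ≋ shift b e ⊙ shift a d
  shift-comm a d b e f k = ≈-reflexive (begin
    a * (b * f (k + d + e))   ≡⟨ x∙yz≈y∙xz a b (f (k + d + e)) ⟩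
    b * (a * f (k + d + e))   ≡⟨ cong (λ j → b * (a * f j)) swap ⟩
    b * (a * f (k + e + d))   ∎)
    where
    open ≡-Reasoning
    swap : k + d + e ≡ k + e + d
    swap = solve (k ∷ d ∷ e ∷ [])

module Coefficients where
  open import Defs
  open import Data.Nat as ℕ using (zero; suc; s≤s⁻¹)
  import Data.Nat.Properties as ℕ
  open import Data.Integer using (+_; -[1+_]; 0ℤ; 1ℤ; _+_; _*_; -_; _-_; ∣_∣)
  open import Data.Integer.Properties using (+-identityˡ; +-identityʳ; *-zeroʳ; ∣i+j∣≤∣i∣+∣j∣; ∣-i∣≡∣i∣)
  open import Data.Integer.Tactic.RingSolver using (solve)
  open import Data.List using (List; []; _∷_)
  open import Relation.Binary.PropositionalEquality using (_≡_; refl; sym; trans; cong; cong₂; subst; module ≡-Reasoning)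
  open ≡-Reasoning

  coeffℤ : List ℤ → ℤ → ℤ
  coeffℤ cs (+ i) = nthL cs i
  coeffℤ cs -[1+ _ ] = 0ℤ

  coeffAt≡coeffℤ : ∀ l cs k → coeffAt (laurent l cs) k ≡ coeffℤ cs (k - l)
  coeffAt≡coeffℤ l cs k with k - l
  ... | + i = refl
  ... | -[1+ _ ] = refl

  coeffℤ-[] : ∀ i → coeffℤ [] i ≡ 0ℤ
  coeffℤ-[] (+ i) = refl
  coeffℤ-[] -[1+ _ ] = refl

  coeffℤ-0∷ : ∀ cs i → coeffℤ (0ℤ ∷ cs) i ≡ coeffℤ cs (i - 1ℤ)
  coeffℤ-0∷ cs (+ zero) = refl
  coeffℤ-0∷ cs (+ suc i) = refl
  coeffℤ-0∷ cs -[1+ _ ] = refl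

  coeffℤ-addL : ∀ xs ys i → coeffℤ (addL xs ys) i ≡ coeffℤ xs i + coeffℤ ys i
  coeffℤ-addL xs ys -[1+ _ ] = refl
  coeffℤ-addL [] ys (+ i) = sym (+-identityˡ _)
  coeffℤ-addL (x ∷ xs) [] (+ i) = sym (+-identityʳ _)
  coeffℤ-addL (x ∷ xs) (y ∷ ys) (+ zero) = refl
  coeffℤ-addL (x ∷ xs) (y ∷ ys) (+ suc i) = coeffℤ-addL xs ys (+ i)

  coeffℤ-scaleL : ∀ a xs i → coeffℤ (scaleL a xs) i ≡ a * coeffℤ xs i
  coeffℤ-scaleL a xs -[1+ _ ] = sym (*-zeroʳ a)
  coeffℤ-scaleL a [] (+ i) = sym (*-zeroʳ a)
  coeffℤ-scaleL a (x ∷ xs) (+ zero) = refl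
  coeffℤ-scaleL a (x ∷ xs) (+ suc i) = coeffℤ-scaleL a xs (+ i)

  coeffℤ-mulL-∷ : ∀ a as ys i → coeffℤ (mulL (a ∷ as) ys) i ≡ a * coeffℤ ys i + coeffℤ (mulL as ys) (i - 1ℤ)
  coeffℤ-mulL-∷ a as ys i = begin
    coeffℤ (addL (scaleL a ys) (0ℤ ∷ mulL as ys)) i          ≡⟨ coeffℤ-addL (scaleL a ys) _ i ⟩
    coeffℤ (scaleL a ys) i + coeffℤ (0ℤ ∷ mulL as ys) i      ≡⟨ cong₂ _+_ (coeffℤ-scaleL a ys i) (coeffℤ-0∷ _ i) ⟩
    a * coeffℤ ys i + coeffℤ (mulL as ys) (i - 1ℤ)           ∎

  coeffℤ-mulL-3 : ∀ a b c ys i → coeffℤ (mulL (a ∷ b ∷ c ∷ []) ys) i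
                ≡ a * coeffℤ ys i + (b * coeffℤ ys (i - 1ℤ) + c * coeffℤ ys (i - 1ℤ - 1ℤ))
  coeffℤ-mulL-3 a b c ys i = begin
    coeffℤ (mulL (a ∷ b ∷ c ∷ []) ys) i
      ≡⟨ coeffℤ-mulL-∷ a (b ∷ c ∷ []) ys i ⟩
    a * Y i + coeffℤ (mulL (b ∷ c ∷ []) ys) (i - 1ℤ)
      ≡⟨ cong (_+_ (a * Y i)) (coeffℤ-mulL-∷ b (c ∷ []) ys (i - 1ℤ)) ⟩
    a * Y i + (b * Y (i - 1ℤ) + coeffℤ (mulL (c ∷ []) ys) (i - 1ℤ - 1ℤ))
      ≡⟨ cong (λ z → a * Y i + (b * Y (i - 1ℤ) + z)) (coeffℤ-mulL-∷ c [] ys (i - 1ℤ - 1ℤ)) ⟩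
    a * Y i + (b * Y (i - 1ℤ) + (c * Y (i - 1ℤ - 1ℤ) + coeffℤ [] (i - 1ℤ - 1ℤ - 1ℤ)))
      ≡⟨ cong (λ z → a * Y i + (b * Y (i - 1ℤ) + (c * Y (i - 1ℤ - 1ℤ) + z))) (coeffℤ-[] (i - 1ℤ - 1ℤ - 1ℤ)) ⟩
    a * Y i + (b * Y (i - 1ℤ) + (c * Y (i - 1ℤ - 1ℤ) + 0ℤ))
      ≡⟨ cong (λ z → a * Y i + (b * Y (i - 1ℤ) + z)) (+-identityʳ _) ⟩
    a * Y i + (b * Y (i - 1ℤ) + c * Y (i - 1ℤ - 1ℤ))
      ∎
    where Y = coeffℤ ys

  coeffAt-P₃*L : ∀ αm α0 α1 R k → coeffAt (P₃ αm α0 α1 *L R) k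
               ≡ αm * coeffAt R (k + 1ℤ) + (α0 * coeffAt R k + α1 * coeffAt R (k - 1ℤ))
  coeffAt-P₃*L αm α0 α1 (laurent l cs) k = begin
    coeffAt (laurent (- 1ℤ + l) (mulL (αm ∷ α0 ∷ α1 ∷ []) cs)) k
      ≡⟨ coeffAt≡coeffℤ _ _ k ⟩
    coeffℤ (mulL (αm ∷ α0 ∷ α1 ∷ []) cs) i
      ≡⟨ coeffℤ-mulL-3 αm α0 α1 cs i ⟩
    αm * c i + (α0 * c (i - 1ℤ) + α1 * c (i - 1ℤ - 1ℤ))
      ≡⟨ cong₂ (λ u v → αm * c u + (α0 * c v + α1 * c (i - 1ℤ - 1ℤ))) index₀ index₁ ⟩
    αm * c (k + 1ℤ - l) + (α0 * c (k - l) + α1 * c (i - 1ℤ - 1ℤ))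
      ≡⟨ cong (λ u → αm * c (k + 1ℤ - l) + (α0 * c (k - l) + α1 * c u)) index₂ ⟩
    αm * c (k + 1ℤ - l) + (α0 * c (k - l) + α1 * c (k - 1ℤ - l))
      ≡⟨ cong₂ (λ u v → αm * u + (α0 * v + α1 * c (k - 1ℤ - l)))
               (coeffAt≡coeffℤ l cs (k + 1ℤ)) (coeffAt≡coeffℤ l cs k) ⟨
    αm * coeffAt R (k + 1ℤ) + (α0 * coeffAt R k + α1 * c (k - 1ℤ - l))
      ≡⟨ cong (λ u → αm * coeffAt R (k + 1ℤ) + (α0 * coeffAt R k + α1 * u)) (coeffAt≡coeffℤ l cs (k - 1ℤ)) ⟨
    αm * coeffAt R (k + 1ℤ) + (α0 * coeffAt R k + α1 * coeffAt R (k - 1ℤ))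
      ∎
    where
    R = laurent l cs
    i = k - (- 1ℤ + l)
    c = coeffℤ cs
    index₀ : k - (- 1ℤ + l) ≡ k + 1ℤ - l
    index₀ = solve (k ∷ l ∷ [])
    index₁ : k - (- 1ℤ + l) - 1ℤ ≡ k - l
    index₁ = solve (k ∷ l ∷ [])
    index₂ : k - (- 1ℤ + l) - 1ℤ - 1ℤ ≡ k - 1ℤ - l
    index₂ = solve (k ∷ l ∷ [])

  ∣k∣≤∣-d∣+∣k+d∣ : ∀ k d → ∣ k ∣ ℕ.≤ ∣ - d ∣ ℕ.+ ∣ k + d ∣
  ∣k∣≤∣-d∣+∣k+d∣ k d =
    subst (λ z → ∣ z ∣ ℕ.≤ ∣ - d ∣ ℕ.+ ∣ k + d ∣) cancel (∣i+j∣≤∣i∣+∣j∣ (- d) (k + d))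
    where
    cancel : - d + (k + d) ≡ k
    cancel = solve (k ∷ d ∷ [])

  <-∣neighbour∣ : ∀ {r} k d → ∣ d ∣ ≡ 1 → suc r ℕ.< ∣ k ∣ → r ℕ.< ∣ k + d ∣
  <-∣neighbour∣ k d ∣d∣≡1 1+r<∣k∣ = s≤s⁻¹ (ℕ.≤-trans 1+r<∣k∣
    (subst (λ e → ∣ k ∣ ℕ.≤ e ℕ.+ ∣ k + d ∣) (trans (∣-i∣≡∣i∣ d) ∣d∣≡1) (∣k∣≤∣-d∣+∣k+d∣ k d)))

module CoefficientsOfPowers (αm α0 α1 : ℤ) where
  open import Defs
  open import Data.Nat as ℕ using (zero; suc)
  import Data.Nat.Properties as ℕ
  open import Data.Integer using (+_; -[1+_]; 0ℤ; 1ℤ; _+_; _*_; -_; _-_; ∣_∣)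
  open import Data.Integer.Tactic.RingSolver using (solve)
  open import Data.List using (_∷_; [])
  open import Relation.Binary.PropositionalEquality using (_≡_; refl; cong; cong₂; module ≡-Reasoning)
  open ≡-Reasoning
  open Coefficients using (coeffAt-P₃*L; <-∣neighbour∣)

  coeff : ℕ → ℤ → ℤ
  coeff n = coeffAt (P₃ αm α0 α1 ^L n)

  coeff-suc : ∀ n k → coeff (suc n) k ≡ αm * coeff n (k + 1ℤ) + (α0 * coeff n k + α1 * coeff n (k - 1ℤ))
  coeff-suc n = coeffAt-P₃*L αm α0 α1 (P₃ αm α0 α1 ^L n)

  coeff-zero : ∀ k → 0 ℕ.< ∣ k ∣ → coeff 0 k ≡ 0ℤ
  coeff-zero (+ suc _) _ = refl
  coeff-zero -[1+ _ ] _ = refl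

  coeff-support : ∀ r k → r ℕ.< ∣ k ∣ → coeff r k ≡ 0ℤ
  coeff-support zero = coeff-zero
  coeff-support (suc r) k r<∣k∣ = begin
    coeff (suc r) k
      ≡⟨ coeff-suc r k ⟩
    αm * coeff r (k + 1ℤ) + (α0 * coeff r k + α1 * coeff r (k - 1ℤ))
      ≡⟨ cong₂ (λ u v → αm * u + (α0 * coeff r k + α1 * v))
               (coeff-support r (k + 1ℤ) (<-∣neighbour∣ k 1ℤ refl r<∣k∣))
               (coeff-support r (k - 1ℤ) (<-∣neighbour∣ k (- 1ℤ) refl r<∣k∣)) ⟩
    αm * 0ℤ + (α0 * coeff r k + α1 * 0ℤ)
      ≡⟨ cong (λ v → αm * 0ℤ + (α0 * v + α1 * 0ℤ)) (coeff-support r k (ℕ.<⇒≤ r<∣k∣)) ⟩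
    αm * 0ℤ + (α0 * 0ℤ + α1 * 0ℤ)
      ≡⟨ solve (αm ∷ α0 ∷ α1 ∷ []) ⟩
    0ℤ
      ∎

module Lucas (p : ℕ) (p-prime : Prime p) (αm α0 α1 : ℤ) where
  open import Defs using (seqA)
  open import Data.Nat as ℕ using (zero; suc; _<_)
  import Data.Nat.Properties as ℕ
  open import Data.Integer using (+_; -[1+_]; 0ℤ; 1ℤ; _+_; _*_; -_; _-_; ∣_∣)
  import Data.Integer.Properties as ℤ
  open import Data.Integer.Tactic.RingSolver using (solve)
  open import Data.Nat.Tactic.RingSolver using () renaming (solve to ℕsolve)
  open import Data.List using (_∷_; [])
  open import Relation.Binary.PropositionalEquality using (_≡_; sym; trans; cong; cong₂; subst; module ≡-Reasoning)
  open PrimeModulus p p-prime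
  open Operators p
  open Frobenius operator-semiring using (frobenius; *-comm-+)
  open CoefficientsOfPowers αm α0 α1
  open import Algebra.Properties.Semiring.Exp operator-semiring using () renaming (_^_ to _^ᵒ_)

  -- Multiplication by P(x^s).
  timesP : ℤ → Operator
  timesP s = shift αm s ⊕ (shift α0 0ℤ ⊕ shift α1 (- s))

  shift-^p : ∀ a d → shift a d ^ᵒ p ≋ shift a (+ p * d)
  shift-^p a d f k = ≈-trans (≈-reflexive (apply-shift-^ a d p f k)) (*-cong (fermat a) ≈-refl)

  timesP-^p : ∀ s → timesP s ^ᵒ p ≋ timesP (+ p * s)
  timesP-^p s = begin
    (A ⊕ (B ⊕ C)) ^ᵒ p
      ≈⟨ frobenius p-prime p×≋𝟎 {A} {B ⊕ C} (*-comm-+ {A} {B} {C} (shift-comm αm s α0 0ℤ) (shift-comm αm s α1 (- s))) ⟩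
    A ^ᵒ p ⊕ (B ⊕ C) ^ᵒ p
      ≈⟨ (λ f k → +-cong (≈-refl {apply (A ^ᵒ p) f k})
                         (frobenius p-prime p×≋𝟎 {B} {C} (shift-comm α0 0ℤ α1 (- s)) f k)) ⟩
    A ^ᵒ p ⊕ (B ^ᵒ p ⊕ C ^ᵒ p)
      ≈⟨ (λ f k → +-cong (shift-^p αm s f k) (+-cong (shift-^p α0 0ℤ f k) (shift-^p α1 (- s) f k))) ⟩
    shift αm (+ p * s) ⊕ (shift α0 (+ p * 0ℤ) ⊕ shift α1 (+ p * - s))
      ≡⟨ cong₂ (λ d e → shift αm (+ p * s) ⊕ (shift α0 d ⊕ shift α1 e))
               (ℤ.*-zeroʳ (+ p)) (sym (ℤ.neg-distribʳ-* (+ p) s)) ⟩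
    timesP (+ p * s)
      ∎
    where
    open import Relation.Binary.Reasoning.Setoid (Semiring.setoid operator-semiring)
    A = shift αm s
    B = shift α0 0ℤ
    C = shift α1 (- s)

  coeff-suc≈timesP : ∀ n k → coeff (suc n) k ≈ apply (timesP 1ℤ) (coeff n) k
  coeff-suc≈timesP n k = ≈-reflexive (trans (coeff-suc n k)
    (cong (λ j → αm * coeff n (k + 1ℤ) + (α0 * coeff n j + α1 * coeff n (k - 1ℤ))) (sym (ℤ.+-identityʳ k))))

  coeff-+ : ∀ N n k → coeff (N ℕ.+ n) k ≈ apply (timesP 1ℤ ^ᵒ n) (coeff N) k
  coeff-+ N zero k = ≈-reflexive (cong (λ n → coeff n k) (ℕ.+-identityʳ N))
  coeff-+ N (suc n) k = begin
    coeff (N ℕ.+ suc n) k                                    ≡⟨ cong (λ n → coeff n k) (ℕ.+-suc N n) ⟩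
    coeff (suc (N ℕ.+ n)) k                                  ≈⟨ coeff-suc≈timesP (N ℕ.+ n) k ⟩
    apply (timesP 1ℤ) (coeff (N ℕ.+ n)) k                    ≈⟨ apply-cong (timesP 1ℤ) (coeff-+ N n) k ⟩
    apply (timesP 1ℤ) (apply (timesP 1ℤ ^ᵒ n) (coeff N)) k   ∎
    where open import Relation.Binary.Reasoning.Setoid (Semiring.setoid semiring)

  apply-timesP-dilate : ∀ m s f k → apply (timesP (m * s)) f (m * k) ≡ apply (timesP s) (λ j → f (m * j)) k
  apply-timesP-dilate m s f k = begin
    αm * f (m * k + m * s) + (α0 * f (m * k + 0ℤ) + α1 * f (m * k + - (m * s)))
      ≡⟨ cong₂ (λ u v → αm * f u + (α0 * f (m * k + 0ℤ) + α1 * f v)) index₊ index₋ ⟩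
    αm * f (m * (k + s)) + (α0 * f (m * k + 0ℤ) + α1 * f (m * (k + - s)))
      ≡⟨ cong (λ u → αm * f (m * (k + s)) + (α0 * f u + α1 * f (m * (k + - s)))) index₀ ⟩
    αm * f (m * (k + s)) + (α0 * f (m * (k + 0ℤ)) + α1 * f (m * (k + - s)))
      ∎
    where
    open ≡-Reasoning
    index₊ : m * k + m * s ≡ m * (k + s)
    index₊ = solve (m ∷ k ∷ s ∷ [])
    index₀ : m * k + 0ℤ ≡ m * (k + 0ℤ)
    index₀ = solve (m ∷ k ∷ [])
    index₋ : m * k + - (m * s) ≡ m * (k + - s)
    index₋ = solve (m ∷ k ∷ s ∷ [])

  apply-timesP-scale : ∀ s c f k → apply (timesP s) (λ j → c * f j) k ≡ c * apply (timesP s) f k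
  apply-timesP-scale s c f k = factor (f (k + s)) (f (k + 0ℤ)) (f (k + - s))
    where
    factor : ∀ x y z → αm * (c * x) + (α0 * (c * y) + α1 * (c * z)) ≡ c * (αm * x + (α0 * y + α1 * z))
    factor x y z = solve (αm ∷ α0 ∷ α1 ∷ c ∷ x ∷ y ∷ z ∷ [])

  coeff-p*k≡0 : ∀ {r} k → r < p → 0 < ∣ k ∣ → coeff r (+ p * k) ≡ 0ℤ
  coeff-p*k≡0 {r} k r<p 0<∣k∣ = coeff-support r (+ p * k) r<∣pk∣
    where
    r<∣pk∣ : r < ∣ + p * k ∣
    r<∣pk∣ = subst (r <_) (sym (ℤ.abs-* (+ p) k)) (ℕ.<-≤-trans r<p (ℕ.m≤m*n p ∣ k ∣ {{ℕ.>-nonZero 0<∣k∣}}))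

  lucas-base : ∀ {r} → r < p → ∀ k → coeff r (+ p * k) ≈ coeff r 0ℤ * coeff 0 k
  lucas-base {r} r<p (+ zero) = ≈-reflexive (trans (cong (coeff r) (ℤ.*-zeroʳ (+ p))) (sym (ℤ.*-identityʳ (coeff r 0ℤ))))
  lucas-base {r} r<p k@(+ suc _) = ≈-reflexive (trans (coeff-p*k≡0 k r<p ℕ.z<s) (sym (ℤ.*-zeroʳ (coeff r 0ℤ))))
  lucas-base {r} r<p k@(-[1+ _ ]) = ≈-reflexive (trans (coeff-p*k≡0 k r<p ℕ.z<s) (sym (ℤ.*-zeroʳ (coeff r 0ℤ))))

  lucas : ∀ {r} → r < p → ∀ m k → coeff (p ℕ.* m ℕ.+ r) (+ p * k) ≈ coeff r 0ℤ * coeff m k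
  lucas {r} r<p zero k = ≈-trans (≈-reflexive (cong (λ n → coeff (n ℕ.+ r) (+ p * k)) (ℕ.*-zeroʳ p))) (lucas-base r<p k)
  lucas {r} r<p (suc m) k = begin
    coeff (p ℕ.* suc m ℕ.+ r) (+ p * k)                  ≡⟨ cong (λ n → coeff n (+ p * k)) next-block ⟩
    coeff (N ℕ.+ p) (+ p * k)                            ≈⟨ coeff-+ N p (+ p * k) ⟩
    apply (timesP 1ℤ ^ᵒ p) (coeff N) (+ p * k)           ≈⟨ timesP-^p 1ℤ (coeff N) (+ p * k) ⟩
    apply (timesP (+ p * 1ℤ)) (coeff N) (+ p * k)        ≡⟨ apply-timesP-dilate (+ p) 1ℤ (coeff N) k ⟩
    apply (timesP 1ℤ) (λ j → coeff N (+ p * j)) k        ≈⟨ apply-cong (timesP 1ℤ) (lucas r<p m) k ⟩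
    apply (timesP 1ℤ) (λ j → coeff r 0ℤ * coeff m j) k   ≡⟨ apply-timesP-scale 1ℤ (coeff r 0ℤ) (coeff m) k ⟩
    coeff r 0ℤ * apply (timesP 1ℤ) (coeff m) k           ≈⟨ *-cong (≈-refl {coeff r 0ℤ}) (coeff-suc≈timesP m k) ⟨
    coeff r 0ℤ * coeff (suc m) k                         ∎
    where
    open import Relation.Binary.Reasoning.Setoid (Semiring.setoid semiring)
    N = p ℕ.* m ℕ.+ r
    next-block : p ℕ.* suc m ℕ.+ r ≡ p ℕ.* m ℕ.+ r ℕ.+ p
    next-block = ℕsolve (p ∷ m ∷ r ∷ [])

  a : ℕ → ℤ
  a = seqA αm α0 α1

  a-digit : ∀ {r} → r < p → ∀ m → a (p ℕ.* m ℕ.+ r) ≈ a r * a m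
  a-digit {r} r<p m = ≈-trans (≈-reflexive (cong (coeff (p ℕ.* m ℕ.+ r)) (sym (ℤ.*-zeroʳ (+ p))))) (lucas r<p m 0ℤ)

module NatDigits where
  open import Data.Nat
  import Data.Nat.Properties as ℕ
  open import Data.Nat.DivMod using (_/_; _%_; m≡m%n+[m/n]*n; m%n≤m; m∣n⇒o%n%m≡o%m; m≥n⇒m/n>0)
  open import Data.Nat.Divisibility using (_∣_; divides)
  open import Data.Nat.Tactic.RingSolver using (solve)
  open import Data.List using (_∷_; [])
  open import Data.Product using (_×_; _,_)
  open import Relation.Binary.PropositionalEquality using (_≡_; refl; sym; trans; cong; subst)

  n<b^n : ∀ {b} → 1 < b → ∀ n → n < b ^ n
  n<b^n 1<b zero = z<s
  n<b^n {b} 1<b (suc n) = ℕ.≤-<-trans (n<b^n 1<b n) (ℕ.^-monoʳ-< b 1<b (ℕ.n<1+n n))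

  b^i∣b^j : ∀ b {i j} → i ≤ j → b ^ i ∣ b ^ j
  b^i∣b^j b {i} {j} i≤j = divides (b ^ (j ∸ i)) (trans (cong (b ^_) (sym (ℕ.m∸n+n≡m i≤j))) (ℕ.^-distribˡ-+-* b (j ∸ i) i))

  drop-digits : ∀ {P Q} x .{{_ : NonZero P}} .{{_ : NonZero Q}} → P ∣ Q → P < Q → Q ≤ x → P * (x / Q) + x % P < x
  drop-digits {P} {Q} x P∣Q P<Q Q≤x =
    subst (P * H + x % P <_) (sym x≡Q*H+M) (ℕ.+-mono-<-≤ (ℕ.*-monoˡ-< H {{>-nonZero H>0}} P<Q) x%P≤M)
    where
    H = x / Q
    M = x % Q
    H>0 : H > 0
    H>0 = m≥n⇒m/n>0 Q≤x
    x%P≤M : x % P ≤ M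
    x%P≤M = subst (_≤ M) (m∣n⇒o%n%m≡o%m P Q x P∣Q) (m%n≤m M P)
    x≡Q*H+M : x ≡ Q * H + M
    x≡Q*H+M = trans (m≡m%n+[m/n]*n x Q) (trans (ℕ.+-comm M (H * Q)) (cong (_+ M) (ℕ.*-comm H Q)))

  next-block-bounds : ∀ {B Q R y} n → B * Q + R ≡ n → R < B → y < B →
                      n < B * suc Q + y × B * suc Q + y ∸ n < B + B
  next-block-bounds {B} {Q} {R} {y} n refl R<B y<B = n<n′ , n′∸n<B+B
    where
    open ℕ.≤-Reasoning
    n<n′ : B * Q + R < B * suc Q + y
    n<n′ = begin-strict
      B * Q + R       <⟨ ℕ.+-monoʳ-< (B * Q) R<B ⟩
      B * Q + B       ≡⟨ ℕ.+-comm (B * Q) B ⟩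
      B + B * Q       ≡⟨ ℕ.*-suc B Q ⟨
      B * suc Q       ≤⟨ ℕ.m≤m+n (B * suc Q) y ⟩
      B * suc Q + y   ∎
    n′<n+[B+B] : B * suc Q + y < B * Q + R + (B + B)
    n′<n+[B+B] = begin-strict
      B * suc Q + y         <⟨ ℕ.+-monoʳ-< (B * suc Q) y<B ⟩
      B * suc Q + B         ≡⟨ solve (B ∷ Q ∷ []) ⟩
      B * Q + (B + B)       ≤⟨ ℕ.+-monoˡ-≤ (B + B) (ℕ.m≤m+n (B * Q) R) ⟩
      B * Q + R + (B + B)   ∎
    n′∸n<B+B : B * suc Q + y ∸ (B * Q + R) < B + B
    n′∸n<B+B = subst (B * suc Q + y ∸ (B * Q + R) <_) (ℕ.m+n∸m≡n (B * Q + R) (B + B))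
                     (ℕ.∸-monoˡ-< n′<n+[B+B] (ℕ.<⇒≤ n<n′))

module LucasProperty (p : ℕ) (p-prime : Prime p) (a : ℕ → ℤ) where
  open import Data.Nat
  import Data.Nat.Properties as ℕ
  open import Data.Nat.DivMod using (_/_; _%_; m≡m%n+[m/n]*n; m%n<n; m<n*o⇒m/o<n)
  open import Data.Nat.Induction using (<-rec)
  open import Data.Nat.Tactic.RingSolver using (solve-∀)
  import Data.Integer as ℤ
  open import Data.Integer using (+_)
  import Data.Integer.Properties as ℤ
  open import Data.Integer.Divisibility using () renaming (_∣_ to _∣ℤ_)
  open import Data.Fin using (toℕ)
  open import Data.Fin.Properties using (pigeonhole; toℕ<n)
  open import Data.Product using (_×_; _,_; ∃-syntax)
  open import Relation.Nullary using (¬_; yes; no)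
  open import Relation.Binary.PropositionalEquality using (_≡_; sym; trans; cong; subst)
  open PrimeModulus p p-prime renaming (_^_ to _^ℤ_)
  open NatDigits
  open import Relation.Binary.Reasoning.Setoid (Semiring.setoid semiring)
  open import Algebra.Properties.CommutativeSemigroup ℤ.*-commutativeSemigroup using (xy∙z≈x∙zy)

  infixl 7 _mod-p^_ _div-p^_
  _mod-p^_ _div-p^_ : ℕ → ℕ → ℕ
  x mod-p^ K = (x % p ^ K) {{ℕ.m^n≢0 p K}}
  x div-p^ K = (x / p ^ K) {{ℕ.m^n≢0 p K}}

  mod-p^<p^ : ∀ x K → x mod-p^ K < p ^ K
  mod-p^<p^ x K = m%n<n x (p ^ K) {{ℕ.m^n≢0 p K}}

  div-mod-p^ : ∀ x K → p ^ K * (x div-p^ K) + x mod-p^ K ≡ x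
  div-mod-p^ x K = sym (trans (m≡m%n+[m/n]*n x (p ^ K) {{ℕ.m^n≢0 p K}})
                              (trans (ℕ.+-comm (x mod-p^ K) _) (cong (_+ x mod-p^ K) (ℕ.*-comm (x div-p^ K) (p ^ K)))))

  module _ (a-0 : a 0 ≡ ℤ.1ℤ) (a-digit : ∀ {r} → r < p → ∀ m → a (p * m + r) ≈ a r ℤ.* a m) where

    a-concat : ∀ K q {r} → r < p ^ K → a (p ^ K * q + r) ≈ a r ℤ.* a q
    a-concat zero q {zero} _ = begin
      a (1 * q + 0)     ≡⟨ cong a (trans (ℕ.+-identityʳ (1 * q)) (ℕ.*-identityˡ q)) ⟩
      a q               ≡⟨ ℤ.*-identityˡ (a q) ⟨
      ℤ.1ℤ ℤ.* a q      ≡⟨ cong (ℤ._* a q) a-0 ⟨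
      a 0 ℤ.* a q       ∎
    a-concat zero q {suc r} (s≤s ())
    a-concat (suc K) q {r} r<p^1+K = begin
      a (p ^ suc K * q + r)          ≡⟨ cong a split ⟩
      a (p * (p ^ K * q + r₁) + r₀)  ≈⟨ a-digit r₀<p (p ^ K * q + r₁) ⟩
      a r₀ ℤ.* a (p ^ K * q + r₁)    ≈⟨ *-cong (≈-refl {a r₀}) (a-concat K q r₁<p^K) ⟩
      a r₀ ℤ.* (a r₁ ℤ.* a q)        ≡⟨ ℤ.*-assoc (a r₀) (a r₁) (a q) ⟨
      a r₀ ℤ.* a r₁ ℤ.* a q          ≈⟨ *-cong (a-digit r₀<p r₁) (≈-refl {a q}) ⟨
      a (p * r₁ + r₀) ℤ.* a q        ≡⟨ cong (λ n → a n ℤ.* a q) r≡p*r₁+r₀ ⟨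
      a r ℤ.* a q                    ∎
      where
      r₀ = r % p
      r₁ = r / p
      r₀<p : r₀ < p
      r₀<p = m%n<n r p
      r₁<p^K : r₁ < p ^ K
      r₁<p^K = m<n*o⇒m/o<n (subst (r <_) (ℕ.*-comm p (p ^ K)) r<p^1+K)
      r≡p*r₁+r₀ : r ≡ p * r₁ + r₀
      r≡p*r₁+r₀ = trans (m≡m%n+[m/n]*n r p) (trans (ℕ.+-comm r₀ (r₁ * p)) (cong (_+ r₀) (ℕ.*-comm r₁ p)))
      split : p ^ suc K * q + r ≡ p * (p ^ K * q + r₁) + r₀
      split = trans (cong (_+_ (p ^ suc K * q)) r≡p*r₁+r₀) (regroup p (p ^ K) q r₁ r₀)
        where
        regroup : ∀ p P q r₁ r₀ → p * P * q + (p * r₁ + r₀) ≡ p * (P * q + r₁) + r₀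
        regroup = solve-∀

    a-append : ∀ x u → a (p ^ x * u + x) ≈ a x ℤ.* a u
    a-append x u = a-concat x u (n<b^n p>1 x)

    power-index : ∀ n u m → ∃[ x ] a x ≈ a n ℤ.* a u ^ℤ m
    power-index n u zero = n , ≈-reflexive (sym (ℤ.*-identityʳ (a n)))
    power-index n u (suc m) with power-index n u m
    ... | x , ax≈ = p ^ x * u + x , (begin
      a (p ^ x * u + x)               ≈⟨ a-append x u ⟩
      a x ℤ.* a u                     ≈⟨ *-cong ax≈ (≈-refl {a u}) ⟩
      a n ℤ.* a u ^ℤ m ℤ.* a u        ≡⟨ xy∙z≈x∙zy (a n) (a u ^ℤ m) (a u) ⟩
      a n ℤ.* (a u ℤ.* a u ^ℤ m)      ∎)

    a-split : ∀ K x → a x ≈ a (x mod-p^ K) ℤ.* a (x div-p^ K)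
    a-split K x = ≈-trans (≈-reflexive (cong a (sym (div-mod-p^ x K)))) (a-concat K (x div-p^ K) (mod-p^<p^ x K))

    shorter-index : ∀ x → p ^ p ≤ x → ∃[ x′ ] x′ < x × a x′ ≈ a x
    shorter-index x p^p≤x with pigeonhole (ℕ.n<1+n p) (λ i → residue (a (x mod-p^ toℕ i)))
    ... | i , j , i<j , same-residue = x′ , x′<x , (begin
      a x′                                    ≈⟨ a-concat I (x div-p^ J) (mod-p^<p^ x I) ⟩
      a (x mod-p^ I) ℤ.* a (x div-p^ J)       ≈⟨ *-cong (residue-≡⇒≈ {a (x mod-p^ I)} {a (x mod-p^ J)} same-residue)
                                                         (≈-refl {a (x div-p^ J)}) ⟩
      a (x mod-p^ J) ℤ.* a (x div-p^ J)       ≈⟨ a-split J x ⟨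
      a x                                     ∎)
      where
      I = toℕ i
      J = toℕ j
      -- x with its base-p digits at positions I, …, J - 1 deleted
      x′ = p ^ I * (x div-p^ J) + x mod-p^ I
      x′<x : x′ < x
      x′<x = drop-digits x {{ℕ.m^n≢0 p I}} {{ℕ.m^n≢0 p J}} (b^i∣b^j p (ℕ.<⇒≤ i<j)) (ℕ.^-monoʳ-< p p>1 i<j)
                         (ℕ.≤-trans (ℕ.^-monoʳ-≤ p (s≤s⁻¹ (toℕ<n j))) p^p≤x)

    short-index : ∀ x → ∃[ y ] y < p ^ p × a y ≈ a x
    short-index = <-rec _ step
      where
      step : ∀ x → (∀ {x′} → x′ < x → ∃[ y ] y < p ^ p × a y ≈ a x′) → ∃[ y ] y < p ^ p × a y ≈ a x
      step x shorten with x <? p ^ p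
      ... | yes x<p^p = x , x<p^p , ≈-refl
      ... | no x≮p^p with shorter-index x (ℕ.≮⇒≥ x≮p^p)
      ...   | x′ , x′<x , ax′≈ax with shorten x′<x
      ...     | y , y<p^p , ay≈ax′ = y , y<p^p , ≈-trans ay≈ax′ ax′≈ax

    next-block-index : (∀ n → ¬ + p ∣ℤ a n) → ∀ n → ∃[ y ] y < p ^ p × a (p ^ p * suc (n div-p^ p) + y) ≈ a n
    next-block-index p∤a n with power-index n (suc (n div-p^ p)) (p ∸ 2)
    ... | x , ax≈ with short-index x
    ...   | y , y<p^p , ay≈ax = y , y<p^p , (begin
      a (p ^ p * u + y)                    ≈⟨ a-concat p u y<p^p ⟩
      a y ℤ.* a u                          ≈⟨ *-cong (≈-trans ay≈ax ax≈) (≈-refl {a u}) ⟩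
      a n ℤ.* a u ^ℤ (p ∸ 2) ℤ.* a u       ≡⟨ xy∙z≈x∙zy (a n) (a u ^ℤ (p ∸ 2)) (a u) ⟩
      a n ℤ.* (a u ℤ.* a u ^ℤ (p ∸ 2))     ≈⟨ *-cong (≈-refl {a n}) (fermat-inverse {a u} (p∤a u)) ⟩
      a n ℤ.* ℤ.1ℤ                         ≡⟨ ℤ.*-identityʳ (a n) ⟩
      a n                                  ∎)
      where u = suc (n div-p^ p)

open import Defs
open import Data.Nat using (_<_; _≤_; _∸_; _^_; _+_; _*_; suc)
import Data.Nat.Properties as ℕ
open import Data.Integer using (+_)
open import Data.Integer.Base using (_-_)
open import Data.Integer.Divisibility using (_∣_)
open import Data.Product using (∃-syntax; _×_; _,_)
open import Relation.Nullary using (¬_)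
open import Relation.Binary.PropositionalEquality using (refl; cong)

p^p+p^p≤bound : ∀ {p} → 1 < p → p ^ p + p ^ p ≤ p ^ (p ^ (p ∸ 1) + p + 1)
p^p+p^p≤bound {p@(suc _)} p>1 = begin
  p ^ p + p ^ p                   ≡⟨ cong (_+_ (p ^ p)) (ℕ.+-identityʳ (p ^ p)) ⟨
  2 * p ^ p                       ≤⟨ ℕ.*-monoˡ-≤ (p ^ p) p>1 ⟩
  p ^ suc p                       ≡⟨ cong (p ^_) (ℕ.+-comm 1 p) ⟩
  p ^ (p + 1)                     ≤⟨ ℕ.^-monoʳ-≤ p (ℕ.+-monoˡ-≤ 1 (ℕ.m≤n+m p (p ^ (p ∸ 1)))) ⟩
  p ^ (p ^ (p ∸ 1) + p + 1)       ∎
  where open ℕ.≤-Reasoning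

lemma3p4 : (p : ℕ) → Prime p → (αm α0 α1 : ℤ) →
    ((n : ℕ) → ¬ ((+ p) ∣ seqA αm α0 α1 n)) →
    (n : ℕ) → ∃[ n′ ] (n < n′ × (n′ ∸ n) < p ^ (p ^ (p ∸ 1) + p + 1)
      × (+ p) ∣ (seqA αm α0 α1 n′ - seqA αm α0 α1 n))
lemma3p4 p p-prime αm α0 α1 p∤a n =
  let y , y<p^p , a[n′]≈a[n] = next-block-index refl a-digit p∤a n
      n<n′ , n′∸n<2p^p = next-block-bounds n (div-mod-p^ n p) (mod-p^<p^ n p) y<p^p
  in p ^ p * suc (n div-p^ p) + y , n<n′ , ℕ.<-≤-trans n′∸n<2p^p (p^p+p^p≤bound p>1) , ≈⇒∣- a[n′]≈a[n]
  where
  open PrimeModulus p p-prime using (≈⇒∣-; p>1)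
  open Lucas p p-prime αm α0 α1 using (a-digit)
  open LucasProperty p p-prime (seqA αm α0 α1) using (_div-p^_; div-mod-p^; mod-p^<p^; next-block-index)
  open NatDigits using (next-block-bounds)
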